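{- For every $k\in\mathbb{N}$ and every finite $8$-connected set $T\subset\mathbb{Z}^2$ with $|T|=k$, \[ |P_8(T)|\ge\sigma_8(k):=2\big\lceil2\sqrt{k}\big\rceil+4 . \] Moreover, for every $k\in\mathbb{N}$ there exists an $8$-connected set of size $k$ attaining $|P_8(T)|=\sigma_8(k)$.
   Context: $d_8(x,y)=\max\{|x_1-y_1|,|x_2-y_2|\}$ on $\mathbb{Z}^2$; a set $T\subset\mathbb{Z}^2$ is $8$-connected if any two of its points are joined by a sequence of points of $T$ with consecutive points at $d_8$-distance $1$. The site perimeter $P_8(T)$ is the set of points of $\mathbb{Z}^2\setminus T$ at $d_8$-distance $1$ from $T$. -}

module Defs where

open import Data.Nat using (ℕ; zero; suc; _+_; _*_; _≤_; _≤?_; _⊔_)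
open import Data.Integer using (ℤ; ∣_∣; _-_)
open import Data.Product using (_×_; _,_; proj₁; proj₂; Σ; ∃; ∃-syntax)
open import Data.List using (List; length)
open import Data.List.Membership.Propositional using (_∈_; _∉_)
open import Data.List.Relation.Unary.Unique.Propositional using (Unique)
open import Relation.Binary.PropositionalEquality using (_≡_)
open import Relation.Nullary using (yes; no)
open import Function.Bundles using (_⇔_)

Point : Set
Point = ℤ × ℤ

d8 : Point → Point → ℕ
d8 (x₁ , x₂) (y₁ , y₂) = ∣ x₁ - y₁ ∣ ⊔ ∣ x₂ - y₂ ∣

-- A finite set T ⊂ ℤ² is represented by a duplicate-free list; |T| = length.
-- Walk T p q : a sequence of points of T from p to q, consecutive points at d₈-distance 1.
data Walk (T : List Point) : Point → Point → Set where
  here : ∀ {p} → p ∈ T → Walk T p p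
  step : ∀ {p q r} → p ∈ T → d8 p q ≡ 1 → Walk T q r → Walk T p r

Connected8 : List Point → Set
Connected8 T = ∀ p q → p ∈ T → q ∈ T → Walk T p q

InP8 : List Point → Point → Set
InP8 T p = p ∉ T × (∃[ q ] (q ∈ T × d8 p q ≡ 1))

-- P is an enumeration (without repetition) of the set P₈(T);
-- so |P₈(T)| = length P.
EnumP8 : List Point → List Point → Set
EnumP8 T P = Unique P × (∀ p → (p ∈ P ⇔ InP8 T p))

-- ceilSqrt n = ⌈√n⌉ = least m with n ≤ m*m (found by bounded search; m ≤ n suffices)
ceilSqrtFrom : ℕ → ℕ → ℕ → ℕ
ceilSqrtFrom n zero m = m
ceilSqrtFrom n (suc fuel) m with n ≤? m * m
... | yes _ = m
... | no _ = ceilSqrtFrom n fuel (suc m)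

ceilSqrt : ℕ → ℕ
ceilSqrt n = ceilSqrtFrom n n 0

-- σ₈(k) = 2⌈2√k⌉ + 4, using ⌈2√k⌉ = ⌈√(4k)⌉
σ8 : ℕ → ℕ
σ8 k = 2 * ceilSqrt (4 * k) + 4

module Submission where

-- A set T with m distinct abscissae and n distinct ordinates has at most mn points, so
-- ⌈2√|T|⌉ ≤ m + n because 4mn ≤ (m + n)². On the other hand P₈(T) contains 2(m + n) + 4
-- distinct points that are easy to name: for each of the m columns of T and the two empty
-- columns flanking it, the point just above, and the point just below, every point of T within
-- horizontal distance 1; for each of the n rows, the points just left and just right of the row.
-- The column points have no point of T beside them at their own height while the row points
-- do, which keeps the four families apart.
-- For the matching example, let s = ⌈2√k⌉ and fill rows of width ⌊s/2⌋ from the bottom: as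
-- k ≤ ⌊s/2⌋⌈s/2⌉, at most ⌈s/2⌉ rows are used, and the perimeter lies in a frame of
-- 2(⌊s/2⌋ + ⌈s/2⌉) + 4 = σ₈(k) points.

open import Defs
open import Data.Nat as ℕ using (ℕ; zero; suc; _+_; _*_; _∸_; _≤_; _<_; z≤n; s≤s; _⊔_; ⌊_/2⌋; ⌈_/2⌉)
import Data.Nat.Properties as ℕ
open import Data.Nat.DivMod using (_/_; _%_; m%n<n; m≡m%n+[m/n]*n; m/n*n≤m)
open import Data.Nat.Tactic.RingSolver using (solve-∀)
open import Data.Integer as ℤ using (ℤ; +_; -[1+_]; ∣_∣; _⊖_)
import Data.Integer.Properties as ℤ
open import Data.Product using (_×_; _,_; proj₁; proj₂; Σ-syntax; ∃-syntax)
open import Data.Product.Properties using (≡-dec)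
open import Data.Sum using (inj₁; inj₂; [_,_])
open import Data.Empty using (⊥-elim)
open import Data.List using (List; []; _∷_; _++_; map; length; filter; deduplicate; cartesianProduct; upTo)
open import Data.List.Properties using (length-++; length-map; length-upTo)
import Data.List.Extrema ℤ.≤-totalOrder as Extrema
open import Data.List.Membership.Propositional using (_∈_; _∉_; find; lose)
open import Data.List.Membership.Propositional.Properties
open import Data.List.Relation.Binary.Subset.Propositional using (_⊆_)
open import Data.List.Relation.Binary.Disjoint.Propositional using (Disjoint)
open import Data.List.Relation.Unary.Any using (here; there; any?)
open import Data.List.Relation.Unary.All using (All; _∷_)
import Data.List.Relation.Unary.All as All
import Data.List.Relation.Unary.All.Properties as All
open import Data.List.Relation.Unary.AllPairs using (_∷_)
open import Data.List.Relation.Unary.Unique.Propositional using (Unique)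
import Data.List.Relation.Unary.Unique.Propositional.Properties as Unique
import Data.List.Relation.Unary.Unique.DecPropositional.Properties as UniqueDec
open import Function.Base using (_∘_; case_of_)
open import Function.Bundles using (mk⇔; Equivalence)
open import Relation.Binary.Definitions using (tri<; tri≈; tri>)
open import Relation.Binary.PropositionalEquality
  using (_≡_; _≢_; refl; sym; trans; cong; cong₂; subst; subst₂; module ≡-Reasoning)
open import Relation.Nullary using (¬_; Dec; yes; no; ¬?; _×-dec_)
open import Relation.Nullary.Decidable using (map′)
open import Relation.Unary using (Decidable)

private
  variable
    A : Set

∈-++-∷⁻ : ∀ {v x : A} us {vs} → v ∈ us ++ x ∷ vs → v ≢ x → v ∈ us ++ vs
∈-++-∷⁻ us v∈ v≢x with ∈-++⁻ us v∈
... | inj₁ v∈us = ∈-++⁺ˡ v∈us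
... | inj₂ (here v≡x) = ⊥-elim (v≢x v≡x)
... | inj₂ (there v∈vs) = ∈-++⁺ʳ us v∈vs

length-++-∷ : ∀ (x : A) us vs → length (us ++ x ∷ vs) ≡ suc (length (us ++ vs))
length-++-∷ x us vs = begin
  length (us ++ x ∷ vs)          ≡⟨ length-++ us ⟩
  length us + suc (length vs)    ≡⟨ ℕ.+-suc (length us) (length vs) ⟩
  suc (length us + length vs)    ≡⟨ cong suc (length-++ us) ⟨
  suc (length (us ++ vs))        ∎
  where open ≡-Reasoning

unique-⊆⇒length≤ : ∀ {xs ys : List A} → Unique xs → xs ⊆ ys → length xs ≤ length ys
unique-⊆⇒length≤ {xs = []} _ _ = z≤n
unique-⊆⇒length≤ {xs = x ∷ xs} (x∉xs ∷ xs!) xs⊆ys with ∈-∃++ (xs⊆ys (here refl))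
... | us , vs , refl = begin
  suc (length xs)              ≤⟨ s≤s (unique-⊆⇒length≤ xs! xs⊆us++vs) ⟩
  suc (length (us ++ vs))      ≡⟨ length-++-∷ x us vs ⟨
  length (us ++ x ∷ vs)        ∎
  where
  open ℕ.≤-Reasoning
  xs⊆us++vs : xs ⊆ us ++ vs
  xs⊆us++vs v∈xs = ∈-++-∷⁻ us (xs⊆ys (there v∈xs)) (λ v≡x → All.lookup x∉xs v∈xs (sym v≡x))

length-cartesianProduct : ∀ {B : Set} (xs : List A) (ys : List B) →
                          length (cartesianProduct xs ys) ≡ length xs * length ys
length-cartesianProduct [] ys = refl
length-cartesianProduct (x ∷ xs) ys = begin
  length (map (x ,_) ys ++ cartesianProduct xs ys)      ≡⟨ length-++ (map (x ,_) ys) ⟩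
  length (map (x ,_) ys) + length (cartesianProduct xs ys)
    ≡⟨ cong₂ _+_ (length-map (x ,_) ys) (length-cartesianProduct xs ys) ⟩
  length ys + length xs * length ys                    ∎
  where open ≡-Reasoning

length-map-++ : ∀ {B : Set} (f : A → B) xs {ys} → length (map f xs ++ ys) ≡ length xs + length ys
length-map-++ f xs {ys} = trans (length-++ (map f xs)) (cong (_+ length ys) (length-map f xs))

disjoint-by : ∀ {P Q : A → Set} {xs ys} → (∀ {v} → P v → ¬ Q v) → All P xs → All Q ys → Disjoint xs ys
disjoint-by P⇒¬Q Pxs Qys (v∈xs , v∈ys) = P⇒¬Q (All.lookup Pxs v∈xs) (All.lookup Qys v∈ys)

module _ (f : A → ℤ) where
  open Extrema
    using (argmax; argmin; argmax-sel; argmin-sel; f[⊥]≤f[argmax]; f[xs]≤f[argmax]; f[argmin]≤f[⊤]; f[argmin]≤f[xs])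

  -- the default is returned only for the empty list
  argmax′ argmin′ : A → List A → A
  argmax′ d []       = d
  argmax′ _ (x ∷ xs) = argmax f x xs
  argmin′ d []       = d
  argmin′ _ (x ∷ xs) = argmin f x xs

  argmax′-∈ : ∀ {d v xs} → v ∈ xs → argmax′ d xs ∈ xs
  argmax′-∈ {xs = x ∷ xs} _ with argmax-sel f x xs
  ... | inj₁ ≡x = subst (_∈ x ∷ xs) (sym ≡x) (here refl)
  ... | inj₂ ∈xs = there ∈xs

  argmin′-∈ : ∀ {d v xs} → v ∈ xs → argmin′ d xs ∈ xs
  argmin′-∈ {xs = x ∷ xs} _ with argmin-sel f x xs
  ... | inj₁ ≡x = subst (_∈ x ∷ xs) (sym ≡x) (here refl)
  ... | inj₂ ∈xs = there ∈xs

  f≤f[argmax′] : ∀ {d v xs} → v ∈ xs → f v ℤ.≤ f (argmax′ d xs)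
  f≤f[argmax′] {xs = x ∷ xs} (here refl) = f[⊥]≤f[argmax] {f = f} x xs
  f≤f[argmax′] {xs = x ∷ xs} (there v∈xs) = All.lookup (f[xs]≤f[argmax] {f = f} x xs) v∈xs

  f[argmin′]≤f : ∀ {d v xs} → v ∈ xs → f (argmin′ d xs) ℤ.≤ f v
  f[argmin′]≤f {xs = x ∷ xs} (here refl) = f[argmin]≤f[⊤] {f = f} x xs
  f[argmin′]≤f {xs = x ∷ xs} (there v∈xs) = All.lookup (f[argmin]≤f[xs] {f = f} x xs) v∈xs

ceilSqrtFrom-least : ∀ n fuel s m → s ≤ m → n ≤ m * m → ceilSqrtFrom n fuel s ≤ m
ceilSqrtFrom-least n zero s m s≤m _ = s≤m
ceilSqrtFrom-least n (suc fuel) s m s≤m n≤m² with n ℕ.≤? s * s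
... | yes _ = s≤m
... | no n≰s² = ceilSqrtFrom-least n fuel (suc s) m (ℕ.≤∧≢⇒< s≤m s≢m) n≤m²
  where
  s≢m : s ≢ m
  s≢m refl = n≰s² n≤m²

ceilSqrt-least : ∀ {n m} → n ≤ m * m → ceilSqrt n ≤ m
ceilSqrt-least {n} {m} = ceilSqrtFrom-least n n 0 m z≤n

ceilSqrtFrom-sound : ∀ n fuel s → n ≤ (s + fuel) * (s + fuel) → n ≤ ceilSqrtFrom n fuel s * ceilSqrtFrom n fuel s
ceilSqrtFrom-sound n zero s n≤ = subst (λ t → n ≤ t * t) (ℕ.+-identityʳ s) n≤
ceilSqrtFrom-sound n (suc fuel) s n≤ with n ℕ.≤? s * s
... | yes n≤s² = n≤s²
... | no _ = ceilSqrtFrom-sound n fuel (suc s) (subst (λ t → n ≤ t * t) (ℕ.+-suc s fuel) n≤)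

ceilSqrt-sound : ∀ n → n ≤ ceilSqrt n * ceilSqrt n
ceilSqrt-sound zero = z≤n
ceilSqrt-sound n@(suc _) = ceilSqrtFrom-sound n n 0 (ℕ.m≤m*n n n)

4mn≤[m+n]²-≤ : ∀ {m n} → m ≤ n → 4 * (m * n) ≤ (m + n) * (m + n)
4mn≤[m+n]²-≤ {m} m≤n with d , refl ← ℕ.m≤n⇒∃[o]m+o≡n m≤n =
  subst (4 * (m * (m + d)) ≤_) (sym (square m d)) (ℕ.m≤m+n _ (d * d))
  where
  square : ∀ m d → (m + (m + d)) * (m + (m + d)) ≡ 4 * (m * (m + d)) + d * d
  square = solve-∀

4mn≤[m+n]² : ∀ m n → 4 * (m * n) ≤ (m + n) * (m + n)
4mn≤[m+n]² m n with ℕ.≤-total m n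
... | inj₁ m≤n = 4mn≤[m+n]²-≤ m≤n
... | inj₂ n≤m = subst₂ _≤_ (cong (4 *_) (ℕ.*-comm n m)) (cong₂ _*_ (ℕ.+-comm n m) (ℕ.+-comm n m))
                         (4mn≤[m+n]²-≤ n≤m)

data Parity : ℕ → Set where
  even : ∀ a → Parity (a + a)
  odd  : ∀ a → Parity (suc (a + a))

parity : ∀ n → Parity n
parity zero = even 0
parity (suc n) with parity n
... | even a = odd a
... | odd a = subst Parity (cong suc (ℕ.+-suc a a)) (even (suc a))

4k≤s²⇒k≤⌊s/2⌋*⌈s/2⌉ : ∀ k s → 4 * k ≤ s * s → k ≤ ⌊ s /2⌋ * ⌈ s /2⌉
4k≤s²⇒k≤⌊s/2⌋*⌈s/2⌉ k s 4k≤s² with parity s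
... | even a = subst₂ (λ l r → k ≤ l * r) (ℕ.n≡⌊n+n/2⌋ a) (ℕ.n≡⌈n+n/2⌉ a)
                      (ℕ.*-cancelˡ-≤ 4 (ℕ.≤-trans 4k≤s² (ℕ.≤-reflexive (square a))))
  where
  square : ∀ a → (a + a) * (a + a) ≡ 4 * (a * a)
  square = solve-∀
... | odd a = subst₂ (λ l r → k ≤ l * r) (ℕ.n≡⌈n+n/2⌉ a) (cong suc (ℕ.n≡⌊n+n/2⌋ a))
                     (ℕ.≤-pred k<a[a+1]+1)
  where
  square : ∀ a → suc (a + a) * suc (a + a) + 3 ≡ 4 * suc (a * suc a)
  square = solve-∀
  k<a[a+1]+1 : k < suc (a * suc a)
  k<a[a+1]+1 = ℕ.*-cancelˡ-< 4 k (suc (a * suc a))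
    (ℕ.≤-<-trans 4k≤s² (subst (s * s <_) (square a) (ℕ.m<m+n (s * s) (s≤s z≤n))))

∣m⊖n∣≤1⇒m≤1+n : ∀ m n → ∣ m ⊖ n ∣ ≤ 1 → m ≤ suc n
∣m⊖n∣≤1⇒m≤1+n m n ∣m⊖n∣≤1 with m ℕ.≤? suc n
... | yes m≤1+n = m≤1+n
... | no m≰1+n =
  ⊥-elim (ℕ.≤⇒≯ ∣m⊖n∣≤1 (subst (2 ≤_) (sym ∣m⊖n∣≡m∸n) (ℕ.m+n≤o⇒m≤o∸n 2 1+n<m)))
  where
  1+n<m : suc n < m
  1+n<m = ℕ.≰⇒> m≰1+n
  ∣m⊖n∣≡m∸n : ∣ m ⊖ n ∣ ≡ m ∸ n
  ∣m⊖n∣≡m∸n = cong ∣_∣ (ℤ.⊖-≥ (ℕ.≤-trans (ℕ.n≤1+n n) (ℕ.<⇒≤ 1+n<m)))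

i<suc[i] : ∀ i → i ℤ.< ℤ.suc i
i<suc[i] i = ℤ.suc[i]≤j⇒i<j ℤ.≤-refl

pred[i]<i : ∀ i → ℤ.pred i ℤ.< i
pred[i]<i i = ℤ.i≤pred[j]⇒i<j ℤ.≤-refl

∣i-i∣≡0 : ∀ i → ∣ i ℤ.- i ∣ ≡ 0
∣i-i∣≡0 i = cong ∣_∣ (ℤ.+-inverseʳ i)

∣suc[i]-i∣≡1 : ∀ i → ∣ ℤ.suc i ℤ.- i ∣ ≡ 1
∣suc[i]-i∣≡1 i = cong ∣_∣ (trans (ℤ.+-assoc ℤ.1ℤ i (ℤ.- i)) (cong (ℤ._+_ ℤ.1ℤ) (ℤ.+-inverseʳ i)))

∣pred[i]-i∣≡1 : ∀ i → ∣ ℤ.pred i ℤ.- i ∣ ≡ 1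
∣pred[i]-i∣≡1 i = cong ∣_∣ (trans (ℤ.+-assoc ℤ.-1ℤ i (ℤ.- i)) (cong (ℤ._+_ ℤ.-1ℤ) (ℤ.+-inverseʳ i)))

NearColumn : ℤ → Point → Set
NearColumn x q = ∣ x ℤ.- proj₁ q ∣ ≤ 1

nearColumn? : ∀ x → Decidable (NearColumn x)
nearColumn? x q = ∣ x ℤ.- proj₁ q ∣ ℕ.≤? 1

OnRow : ℤ → Point → Set
OnRow y q = proj₂ q ≡ y

onRow? : ∀ y → Decidable (OnRow y)
onRow? y q = proj₂ q ℤ.≟ y

d8-sym : ∀ p q → d8 p q ≡ d8 q p
d8-sym (a , b) (c , d) = cong₂ _⊔_ (ℤ.∣i-j∣≡∣j-i∣ a c) (ℤ.∣i-j∣≡∣j-i∣ b d)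

nearColumn-refl : ∀ p → NearColumn (proj₁ p) p
nearColumn-refl p = subst (_≤ 1) (sym (∣i-i∣≡0 (proj₁ p))) z≤n

nearColumn-suc : ∀ q → NearColumn (ℤ.suc (proj₁ q)) q
nearColumn-suc q = ℕ.≤-reflexive (∣suc[i]-i∣≡1 (proj₁ q))

nearColumn-pred : ∀ q → NearColumn (ℤ.pred (proj₁ q)) q
nearColumn-pred q = ℕ.≤-reflexive (∣pred[i]-i∣≡1 (proj₁ q))

d8-vertical : ∀ {p q} → NearColumn (proj₁ p) q → ∣ proj₂ p ℤ.- proj₂ q ∣ ≡ 1 → d8 p q ≡ 1
d8-vertical near ∣Δy∣≡1 rewrite ∣Δy∣≡1 = ℕ.m≤n⇒m⊔n≡n near

d8-horizontal : ∀ {p q} → ∣ proj₁ p ℤ.- proj₁ q ∣ ≡ 1 → OnRow (proj₂ p) q → d8 p q ≡ 1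
d8-horizontal {p} ∣Δx∣≡1 refl rewrite ∣Δx∣≡1 | ∣i-i∣≡0 (proj₂ p) = refl

∣i-[1+a]∣≤1⇒i≤2+a : ∀ i a → ∣ i ℤ.- + suc a ∣ ≤ 1 → ∃[ c ] i ≡ + c × c ≤ 2 + a
∣i-[1+a]∣≤1⇒i≤2+a -[1+ m ] a (s≤s ())
∣i-[1+a]∣≤1⇒i≤2+a (+ c) a ∣c-a∣≤1 = c , refl , ∣m⊖n∣≤1⇒m≤1+n c (suc a) ∣c-a∣≤1

walk-++ : ∀ {T p q r} → Walk T p q → Walk T q r → Walk T p r
walk-++ (here _) w = w
walk-++ (step p∈T d w) w′ = step p∈T d (walk-++ w w′)

walk-start : ∀ {T p q} → Walk T p q → p ∈ T
walk-start (here p∈T) = p∈T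
walk-start (step p∈T _ _) = p∈T

walk-reverse : ∀ {T p q} → Walk T p q → Walk T q p
walk-reverse (here p∈T) = here p∈T
walk-reverse {p = p} (step {q = q} p∈T d w) =
  walk-++ (walk-reverse w) (step (walk-start w) (trans (d8-sym q p) d) (here p∈T))

connected8-via : ∀ {T} o → (∀ {p} → p ∈ T → Walk T p o) → Connected8 T
connected8-via o walk p q p∈T q∈T = walk-++ (walk p∈T) (walk-reverse (walk q∈T))

_≟ᴾ_ : (p q : Point) → Dec (p ≡ q)
_≟ᴾ_ = ≡-dec ℤ._≟_ ℤ._≟_

open import Data.List.Membership.DecPropositional _≟ᴾ_ using (_∈?_)

inP8? : ∀ T → Decidable (InP8 T)
inP8? T p = ¬? (p ∈? T) ×-dec map′ find (λ (q , q∈T , d) → lose q∈T d) (any? (λ q → d8 p q ℕ.≟ 1) T)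

EnumP8-from-cover : ∀ T L → (∀ {p} → InP8 T p → p ∈ L) → ∃[ P ] EnumP8 T P × length P ≤ length L
EnumP8-from-cover T L cover = P , (P! , λ p → mk⇔ (proj₂ ∘ ∈P⁻) (∈P⁺ p)) , |P|≤|L|
  where
  P : List Point
  P = filter (inP8? T) (deduplicate _≟ᴾ_ L)
  ∈P⁻ : ∀ {p} → p ∈ P → p ∈ deduplicate _≟ᴾ_ L × InP8 T p
  ∈P⁻ = ∈-filter⁻ (inP8? T) {xs = deduplicate _≟ᴾ_ L}
  P! : Unique P
  P! = Unique.filter⁺ (inP8? T) (UniqueDec.deduplicate-! _≟ᴾ_ L)
  ∈P⁺ : ∀ p → InP8 T p → p ∈ P
  ∈P⁺ p p∈P8 = ∈-filter⁺ (inP8? T) (∈-deduplicate⁺ _≟ᴾ_ (cover p∈P8)) p∈P8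
  |P|≤|L| : length P ≤ length L
  |P|≤|L| = unique-⊆⇒length≤ P! (∈-deduplicate⁻ _≟ᴾ_ L ∘ proj₁ ∘ ∈P⁻)

-- The lower bound

module Silhouette (T : List Point) {q₀ : Point} (q₀∈T : q₀ ∈ T) where

  column : ℤ → List Point
  column x = filter (nearColumn? x) T

  row : ℤ → List Point
  row y = filter (onRow? y) T

  ∈column⁻ : ∀ {x q} → q ∈ column x → q ∈ T × NearColumn x q
  ∈column⁻ {x} = ∈-filter⁻ (nearColumn? x) {xs = T}

  ∈column⁺ : ∀ x {q} → q ∈ T → NearColumn x q → q ∈ column x
  ∈column⁺ x = ∈-filter⁺ (nearColumn? x)

  ∈row⁻ : ∀ {y q} → q ∈ row y → q ∈ T × OnRow y q
  ∈row⁻ {y} = ∈-filter⁻ (onRow? y) {xs = T}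

  ∈-own-column : ∀ {p} → p ∈ T → p ∈ column (proj₁ p)
  ∈-own-column {p} p∈T = ∈column⁺ (proj₁ p) p∈T (nearColumn-refl p)

  ∈-own-row : ∀ {p} → p ∈ T → p ∈ row (proj₂ p)
  ∈-own-row {p} p∈T = ∈-filter⁺ (onRow? (proj₂ p)) p∈T refl

  top bottom rightmost leftmost : ℤ → Point
  top x = argmax′ proj₂ q₀ (column x)
  bottom x = argmin′ proj₂ q₀ (column x)
  rightmost y = argmax′ proj₁ q₀ (row y)
  leftmost y = argmin′ proj₁ q₀ (row y)

  above below rightOf leftOf : ℤ → Point
  above x = x , ℤ.suc (proj₂ (top x))
  below x = x , ℤ.pred (proj₂ (bottom x))
  rightOf y = ℤ.suc (proj₁ (rightmost y)) , y
  leftOf y = ℤ.pred (proj₁ (leftmost y)) , y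

  Over Under Level RightOfRow LeftOfRow : Point → Set
  Over p = ∀ {q} → q ∈ column (proj₁ p) → proj₂ q ℤ.< proj₂ p
  Under p = ∀ {q} → q ∈ column (proj₁ p) → proj₂ p ℤ.< proj₂ q
  Level p = ∃[ q ] q ∈ column (proj₁ p) × proj₂ q ≡ proj₂ p
  RightOfRow p = ∀ {q} → q ∈ row (proj₂ p) → proj₁ q ℤ.< proj₁ p
  LeftOfRow p = ∀ {q} → q ∈ row (proj₂ p) → proj₁ p ℤ.< proj₁ q

  over-above : ∀ x → Over (above x)
  over-above x q∈ = ℤ.≤-<-trans (f≤f[argmax′] proj₂ q∈) (i<suc[i] _)

  under-below : ∀ x → Under (below x)
  under-below x q∈ = ℤ.<-≤-trans (pred[i]<i _) (f[argmin′]≤f proj₂ q∈)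

  rightOfRow-rightOf : ∀ y → RightOfRow (rightOf y)
  rightOfRow-rightOf y q∈ = ℤ.≤-<-trans (f≤f[argmax′] proj₁ q∈) (i<suc[i] _)

  leftOfRow-leftOf : ∀ y → LeftOfRow (leftOf y)
  leftOfRow-leftOf y q∈ = ℤ.<-≤-trans (pred[i]<i _) (f[argmin′]≤f proj₁ q∈)

  level-rightOf : ∀ {y q} → q ∈ row y → Level (rightOf y)
  level-rightOf {y} q∈ =
    rightmost y , ∈column⁺ (proj₁ (rightOf y)) (proj₁ r) (nearColumn-suc (rightmost y)) , proj₂ r
    where
    r : rightmost y ∈ T × OnRow y (rightmost y)
    r = ∈row⁻ {y} (argmax′-∈ proj₁ q∈)

  level-leftOf : ∀ {y q} → q ∈ row y → Level (leftOf y)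
  level-leftOf {y} q∈ =
    leftmost y , ∈column⁺ (proj₁ (leftOf y)) (proj₁ l) (nearColumn-pred (leftmost y)) , proj₂ l
    where
    l : leftmost y ∈ T × OnRow y (leftmost y)
    l = ∈row⁻ {y} (argmin′-∈ proj₁ q∈)

  over⇒¬level : ∀ {p} → Over p → ¬ Level p
  over⇒¬level over (q , q∈ , q≡p) = ℤ.<-irrefl q≡p (over q∈)

  under⇒¬level : ∀ {p} → Under p → ¬ Level p
  under⇒¬level under (q , q∈ , q≡p) = ℤ.<-irrefl (sym q≡p) (under q∈)

  over⇒¬under : ∀ {p q} → q ∈ column (proj₁ p) → Over p → ¬ Under p
  over⇒¬under q∈ over under = ℤ.<-asym (over q∈) (under q∈)

  leftOfRow⇒¬rightOfRow : ∀ {p q} → q ∈ row (proj₂ p) → LeftOfRow p → ¬ RightOfRow p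
  leftOfRow⇒¬rightOfRow q∈ left right = ℤ.<-asym (left q∈) (right q∈)

  over⇒∉ : ∀ {p} → Over p → p ∉ T
  over⇒∉ over p∈T = ℤ.<-irrefl refl (over (∈-own-column p∈T))

  under⇒∉ : ∀ {p} → Under p → p ∉ T
  under⇒∉ under p∈T = ℤ.<-irrefl refl (under (∈-own-column p∈T))

  rightOfRow⇒∉ : ∀ {p} → RightOfRow p → p ∉ T
  rightOfRow⇒∉ right p∈T = ℤ.<-irrefl refl (right (∈-own-row p∈T))

  leftOfRow⇒∉ : ∀ {p} → LeftOfRow p → p ∉ T
  leftOfRow⇒∉ left p∈T = ℤ.<-irrefl refl (left (∈-own-row p∈T))

  above∈P8 : ∀ {x q} → q ∈ column x → InP8 T (above x)
  above∈P8 {x} q∈ = over⇒∉ (over-above x) , top x , proj₁ t ,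
                    d8-vertical {above x} {top x} (proj₂ t) (∣suc[i]-i∣≡1 (proj₂ (top x)))
    where
    t : top x ∈ T × NearColumn x (top x)
    t = ∈column⁻ {x} (argmax′-∈ proj₂ q∈)

  below∈P8 : ∀ {x q} → q ∈ column x → InP8 T (below x)
  below∈P8 {x} q∈ = under⇒∉ (under-below x) , bottom x , proj₁ b ,
                    d8-vertical {below x} {bottom x} (proj₂ b) (∣pred[i]-i∣≡1 (proj₂ (bottom x)))
    where
    b : bottom x ∈ T × NearColumn x (bottom x)
    b = ∈column⁻ {x} (argmin′-∈ proj₂ q∈)

  rightOf∈P8 : ∀ {y q} → q ∈ row y → InP8 T (rightOf y)
  rightOf∈P8 {y} q∈ = rightOfRow⇒∉ (rightOfRow-rightOf y) , rightmost y , proj₁ r ,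
                      d8-horizontal {rightOf y} {rightmost y} (∣suc[i]-i∣≡1 (proj₁ (rightmost y))) (proj₂ r)
    where
    r : rightmost y ∈ T × OnRow y (rightmost y)
    r = ∈row⁻ {y} (argmax′-∈ proj₁ q∈)

  leftOf∈P8 : ∀ {y q} → q ∈ row y → InP8 T (leftOf y)
  leftOf∈P8 {y} q∈ = leftOfRow⇒∉ (leftOfRow-leftOf y) , leftmost y , proj₁ l ,
                     d8-horizontal {leftOf y} {leftmost y} (∣pred[i]-i∣≡1 (proj₁ (leftmost y))) (proj₂ l)
    where
    l : leftmost y ∈ T × OnRow y (leftmost y)
    l = ∈row⁻ {y} (argmin′-∈ proj₁ q∈)

  westmost eastmost : Point
  westmost = argmin′ proj₁ q₀ T
  eastmost = argmax′ proj₁ q₀ T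

  X Y : List ℤ
  X = deduplicate ℤ._≟_ (map proj₁ T)
  Y = deduplicate ℤ._≟_ (map proj₂ T)

  columns : List ℤ
  columns = ℤ.pred (proj₁ westmost) ∷ ℤ.suc (proj₁ eastmost) ∷ X

  ∈X⁻ : ∀ {x} → x ∈ X → ∃[ q ] q ∈ T × x ≡ proj₁ q
  ∈X⁻ = ∈-map⁻ proj₁ ∘ ∈-deduplicate⁻ ℤ._≟_ (map proj₁ T)

  ∈Y⁻ : ∀ {y} → y ∈ Y → ∃[ q ] q ∈ T × y ≡ proj₂ q
  ∈Y⁻ = ∈-map⁻ proj₂ ∘ ∈-deduplicate⁻ ℤ._≟_ (map proj₂ T)

  column-occupied : ∀ {x} → x ∈ columns → ∃[ q ] q ∈ column x
  column-occupied (here refl) =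
    westmost , ∈column⁺ (ℤ.pred (proj₁ westmost)) (argmin′-∈ proj₁ q₀∈T) (nearColumn-pred westmost)
  column-occupied (there (here refl)) =
    eastmost , ∈column⁺ (ℤ.suc (proj₁ eastmost)) (argmax′-∈ proj₁ q₀∈T) (nearColumn-suc eastmost)
  column-occupied (there (there x∈X)) with q , q∈T , refl ← ∈X⁻ x∈X = q , ∈-own-column q∈T

  row-occupied : ∀ {y} → y ∈ Y → ∃[ q ] q ∈ row y
  row-occupied y∈Y with q , q∈T , refl ← ∈Y⁻ y∈Y = q , ∈-own-row q∈T

  columns-unique : Unique columns
  columns-unique = (west≢east ∷ All.tabulate west≢X) ∷ All.tabulate east≢X
                 ∷ UniqueDec.deduplicate-! ℤ._≟_ (map proj₁ T)
    where
    west<X : ∀ {x} → x ∈ X → ℤ.pred (proj₁ westmost) ℤ.< x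
    west<X x∈X with q , q∈T , refl ← ∈X⁻ x∈X = ℤ.<-≤-trans (pred[i]<i _) (f[argmin′]≤f proj₁ q∈T)
    X<east : ∀ {x} → x ∈ X → x ℤ.< ℤ.suc (proj₁ eastmost)
    X<east x∈X with q , q∈T , refl ← ∈X⁻ x∈X = ℤ.≤-<-trans (f≤f[argmax′] proj₁ q∈T) (i<suc[i] _)
    west≢X : ∀ {x} → x ∈ X → ℤ.pred (proj₁ westmost) ≢ x
    west≢X x∈X refl = ℤ.<-irrefl refl (west<X x∈X)
    east≢X : ∀ {x} → x ∈ X → ℤ.suc (proj₁ eastmost) ≢ x
    east≢X x∈X refl = ℤ.<-irrefl refl (X<east x∈X)
    west≢east : ℤ.pred (proj₁ westmost) ≢ ℤ.suc (proj₁ eastmost)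
    west≢east = ℤ.<⇒≢ (ℤ.<-trans (west<X east∈X) (i<suc[i] _))
      where
      east∈X : proj₁ eastmost ∈ X
      east∈X = ∈-deduplicate⁺ ℤ._≟_ (∈-map⁺ proj₁ (argmax′-∈ proj₁ q₀∈T))

  boundary : List Point
  boundary = map above columns ++ map below columns ++ map leftOf Y ++ map rightOf Y

  boundary⊆P8 : All (InP8 T) boundary
  boundary⊆P8 =
    All.++⁺ (All.map⁺ (All.tabulate (above∈P8 ∘ proj₂ ∘ column-occupied))) (
    All.++⁺ (All.map⁺ (All.tabulate (below∈P8 ∘ proj₂ ∘ column-occupied))) (
    All.++⁺ (All.map⁺ (All.tabulate (leftOf∈P8 ∘ proj₂ ∘ row-occupied)))
            (All.map⁺ (All.tabulate (rightOf∈P8 ∘ proj₂ ∘ row-occupied)))))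

  aboves-over : All (λ p → Over p × ∃[ q ] q ∈ column (proj₁ p)) (map above columns)
  aboves-over = All.map⁺ (All.tabulate λ {x} x∈ → over-above x , column-occupied x∈)

  belows-under : All Under (map below columns)
  belows-under = All.map⁺ (All.tabulate λ {x} _ → under-below x)

  lefts-leftOfRow : All (λ p → LeftOfRow p × ∃[ q ] q ∈ row (proj₂ p)) (map leftOf Y)
  lefts-leftOfRow = All.map⁺ (All.tabulate λ {y} y∈ → leftOfRow-leftOf y , row-occupied y∈)

  rights-rightOfRow : All RightOfRow (map rightOf Y)
  rights-rightOfRow = All.map⁺ (All.tabulate λ {y} _ → rightOfRow-rightOf y)

  sides-level : All Level (map leftOf Y ++ map rightOf Y)
  sides-level = All.++⁺ (All.map⁺ (All.tabulate (level-leftOf ∘ proj₂ ∘ row-occupied)))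
                        (All.map⁺ (All.tabulate (level-rightOf ∘ proj₂ ∘ row-occupied)))

  lefts-disjoint-rights : Disjoint (map leftOf Y) (map rightOf Y)
  lefts-disjoint-rights =
    disjoint-by (λ {p} (left , _ , q∈) → leftOfRow⇒¬rightOfRow {p} q∈ left) lefts-leftOfRow rights-rightOfRow

  belows-disjoint-sides : Disjoint (map below columns) (map leftOf Y ++ map rightOf Y)
  belows-disjoint-sides = disjoint-by (λ {p} → under⇒¬level {p}) belows-under sides-level

  aboves-disjoint-rest : Disjoint (map above columns) (map below columns ++ map leftOf Y ++ map rightOf Y)
  aboves-disjoint-rest =
    disjoint-by (λ {p} (over , _ , q∈) → [ over⇒¬under {p} q∈ over , over⇒¬level {p} over ]) aboves-over
                (All.++⁺ (All.map inj₁ belows-under) (All.map inj₂ sides-level))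

  boundary-unique : Unique boundary
  boundary-unique =
    Unique.++⁺ (Unique.map⁺ (cong proj₁) columns-unique) (
    Unique.++⁺ (Unique.map⁺ (cong proj₁) columns-unique) (
    Unique.++⁺ (Unique.map⁺ (cong proj₂) Y-unique) (Unique.map⁺ (cong proj₂) Y-unique)
      lefts-disjoint-rights) belows-disjoint-sides) aboves-disjoint-rest
    where
    Y-unique : Unique Y
    Y-unique = UniqueDec.deduplicate-! ℤ._≟_ (map proj₂ T)

  length-boundary : length boundary ≡ 2 * (length X + length Y) + 4
  length-boundary = begin
    length boundary
      ≡⟨ length-map-++ above columns ⟩
    length columns + length (map below columns ++ map leftOf Y ++ map rightOf Y)
      ≡⟨ cong (λ n → length columns + n) (length-map-++ below columns) ⟩
    length columns + (length columns + length (map leftOf Y ++ map rightOf Y))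
      ≡⟨ cong (λ n → length columns + (length columns + n)) (length-map-++ leftOf Y) ⟩
    length columns + (length columns + (length Y + length (map rightOf Y)))
      ≡⟨ cong (λ n → length columns + (length columns + (length Y + n))) (length-map rightOf Y) ⟩
    suc (suc (length X)) + (suc (suc (length X)) + (length Y + length Y))
      ≡⟨ count (length X) (length Y) ⟩
    2 * (length X + length Y) + 4 ∎
    where
    open ≡-Reasoning
    count : ∀ m n → suc (suc m) + (suc (suc m) + (n + n)) ≡ 2 * (m + n) + 4
    count = solve-∀

  length≤|X|*|Y| : Unique T → length T ≤ length X * length Y
  length≤|X|*|Y| T! = begin
    length T                          ≤⟨ unique-⊆⇒length≤ T! T⊆X×Y ⟩
    length (cartesianProduct X Y)     ≡⟨ length-cartesianProduct X Y ⟩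
    length X * length Y               ∎
    where
    open ℕ.≤-Reasoning
    T⊆X×Y : T ⊆ cartesianProduct X Y
    T⊆X×Y q∈T = ∈-cartesianProduct⁺ (∈-deduplicate⁺ ℤ._≟_ (∈-map⁺ proj₁ q∈T))
                                    (∈-deduplicate⁺ ℤ._≟_ (∈-map⁺ proj₂ q∈T))

σ8≤|P8| : ∀ T {q₀} → q₀ ∈ T → Unique T → ∀ P → EnumP8 T P → σ8 (length T) ≤ length P
σ8≤|P8| T q₀∈T T! P (_ , P≡P8) = begin
  2 * ceilSqrt (4 * length T) + 4    ≤⟨ ℕ.+-monoˡ-≤ 4 (ℕ.*-monoʳ-≤ 2 ⌈√4k⌉≤m+n) ⟩
  2 * (length X + length Y) + 4      ≡⟨ length-boundary ⟨
  length boundary                    ≤⟨ unique-⊆⇒length≤ boundary-unique boundary⊆P ⟩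
  length P                           ∎
  where
  open Silhouette T q₀∈T
  open ℕ.≤-Reasoning
  4k≤[m+n]² : 4 * length T ≤ (length X + length Y) * (length X + length Y)
  4k≤[m+n]² = ℕ.≤-trans (ℕ.*-monoʳ-≤ 4 (length≤|X|*|Y| T!)) (4mn≤[m+n]² (length X) (length Y))
  ⌈√4k⌉≤m+n : ceilSqrt (4 * length T) ≤ length X + length Y
  ⌈√4k⌉≤m+n = ceilSqrt-least {m = length X + length Y} 4k≤[m+n]²
  boundary⊆P : boundary ⊆ P
  boundary⊆P p∈ = Equivalence.from (P≡P8 _) (All.lookup boundary⊆P8 p∈)

-- The extremal sets

-- Rows 1, …, g of width w topped by the first j cells of row g + 1, with columns 1, …, w.
module Staircase (w g j : ℕ) (j≤w : j ≤ w) where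

  pt : ℕ → ℕ → Point
  pt c e = + c , + e

  cell : ℕ × ℕ → Point
  cell (a , b) = pt (suc a) (suc b)

  cell-injective : ∀ {u v} → cell u ≡ cell v → u ≡ v
  cell-injective eq = cong₂ _,_ (ℕ.suc-injective (ℤ.+-injective (cong proj₁ eq)))
                                (ℕ.suc-injective (ℤ.+-injective (cong proj₂ eq)))

  data Cell : ℕ × ℕ → Set where
    body : ∀ {a b} → a < w → b < g → Cell (a , b)
    cap  : ∀ {a} → a < j → Cell (a , g)

  bodyCells capCells T : List Point
  bodyCells = map cell (cartesianProduct (upTo w) (upTo g))
  capCells = map (λ a → cell (a , g)) (upTo j)
  T = bodyCells ++ capCells

  cell∈T : ∀ {u} → Cell u → cell u ∈ T
  cell∈T (body a<w b<g) = ∈-++⁺ˡ (∈-map⁺ cell (∈-cartesianProduct⁺ (∈-upTo⁺ a<w) (∈-upTo⁺ b<g)))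
  cell∈T (cap a<j) = ∈-++⁺ʳ bodyCells (∈-map⁺ (λ a → cell (a , g)) (∈-upTo⁺ a<j))

  ∈T⇒cell : ∀ {p} → p ∈ T → ∃[ u ] p ≡ cell u × Cell u
  ∈T⇒cell p∈T with ∈-++⁻ bodyCells p∈T
  ... | inj₁ p∈body
          with (a , b) , ab∈ , refl ← ∈-map⁻ cell p∈body
          with a∈ , b∈ ← ∈-cartesianProduct⁻ (upTo w) (upTo g) ab∈
          = (a , b) , refl , body (∈-upTo⁻ a∈) (∈-upTo⁻ b∈)
  ... | inj₂ p∈cap
          with a , a∈ , refl ← ∈-map⁻ (λ a → cell (a , g)) p∈cap
          = (a , g) , refl , cap (∈-upTo⁻ a∈)

  T-unique : Unique T
  T-unique = Unique.++⁺ (Unique.map⁺ cell-injective (Unique.cartesianProduct⁺ (Unique.upTo⁺ w) (Unique.upTo⁺ g)))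
                        (Unique.map⁺ (cong proj₁ ∘ cell-injective) (Unique.upTo⁺ j))
                        (disjoint-by (λ below≢ ≡top → below≢ ≡top) below-cap on-cap)
    where
    below-cap : All (λ p → proj₂ p ≢ + suc g) bodyCells
    below-cap = All.map⁺ (All.tabulate λ ab∈ eq → ℕ.<-irrefl (ℕ.suc-injective (ℤ.+-injective eq))
                                                            (∈-upTo⁻ (proj₂ (∈-cartesianProduct⁻ (upTo w) (upTo g) ab∈))))
    on-cap : All (λ p → proj₂ p ≡ + suc g) capCells
    on-cap = All.map⁺ (All.tabulate λ _ → refl)

  T-length : length T ≡ w * g + j
  T-length = trans (length-++ bodyCells) (cong₂ _+_ |body| |cap|)
    where
    open ≡-Reasoning
    |body| : length bodyCells ≡ w * g
    |body| = begin
      length bodyCells                                ≡⟨ length-map cell (cartesianProduct (upTo w) (upTo g)) ⟩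
      length (cartesianProduct (upTo w) (upTo g))     ≡⟨ length-cartesianProduct (upTo w) (upTo g) ⟩
      length (upTo w) * length (upTo g)               ≡⟨ cong₂ _*_ (length-upTo w) (length-upTo g) ⟩
      w * g                                           ∎
    |cap| : length capCells ≡ j
    |cap| = trans (length-map _ (upTo j)) (length-upTo j)

  cell-down : ∀ {a b} → Cell (a , suc b) → Cell (a , b)
  cell-down (body a<w b<g) = body a<w (ℕ.<-trans (ℕ.n<1+n _) b<g)
  cell-down (cap a<j) = body (ℕ.<-≤-trans a<j j≤w) (ℕ.n<1+n _)

  cell-left : ∀ {a} → Cell (suc a , 0) → Cell (a , 0)
  cell-left (body a<w 0<g) = body (ℕ.<-trans (ℕ.n<1+n _) a<w) 0<g
  cell-left (cap a<j) = cap (ℕ.<-trans (ℕ.n<1+n _) a<j)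

  walk-down : ∀ a b → Cell (a , b) → Walk T (cell (a , b)) (cell (a , 0))
  walk-down a zero c = here (cell∈T c)
  walk-down a (suc b) c =
    step (cell∈T c) (d8-vertical {cell (a , suc b)} {cell (a , b)} (nearColumn-refl (cell (a , b))) (∣suc[i]-i∣≡1 (+ suc b)))
         (walk-down a b (cell-down c))

  walk-left : ∀ a → Cell (a , 0) → Walk T (cell (a , 0)) (cell (0 , 0))
  walk-left zero c = here (cell∈T c)
  walk-left (suc a) c =
    step (cell∈T c) (d8-horizontal {cell (suc a , 0)} {cell (a , 0)} (∣suc[i]-i∣≡1 (+ suc a)) refl)
         (walk-left a (cell-left c))

  cell-bottom : ∀ {a b} → Cell (a , b) → Cell (a , 0)
  cell-bottom {b = zero} c = c
  cell-bottom {b = suc b} c = cell-bottom (cell-down c)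

  T-connected : Connected8 T
  T-connected = connected8-via (cell (0 , 0)) λ p∈T → case ∈T⇒cell p∈T of λ where
    ((a , b) , refl , c) → walk-++ (walk-down a b c) (walk-left a (cell-bottom c))

  -- P₈(T) lies on the frame x = 0 (y ≤ g + 2), x = w + 1 (y ≤ g), y = 0 (1 ≤ x ≤ w),
  -- y = g + 2 (1 ≤ x ≤ j + 1) and y = g + 1 (j + 1 ≤ x ≤ w + 1).
  west east floor roof ledge cover : List Point
  west = map (pt 0) (upTo (3 + g))
  east = map (pt (suc w)) (upTo (suc g))
  floor = map (λ a → pt (suc a) 0) (upTo w)
  roof = map (λ a → pt (suc a) (2 + g)) (upTo (suc j))
  ledge = map (λ t → pt (suc (j + t)) (suc g)) (upTo (suc (w ∸ j)))
  cover = west ++ east ++ floor ++ roof ++ ledge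

  ∈west : ∀ {e} → e ≤ 2 + g → pt 0 e ∈ cover
  ∈west e≤ = ∈-++⁺ˡ (∈-map⁺ (pt 0) (∈-upTo⁺ (s≤s e≤)))

  ∈east : ∀ {e} → e ≤ g → pt (suc w) e ∈ cover
  ∈east e≤ = ∈-++⁺ʳ west (∈-++⁺ˡ (∈-map⁺ (pt (suc w)) (∈-upTo⁺ (s≤s e≤))))

  ∈floor : ∀ {a} → a < w → pt (suc a) 0 ∈ cover
  ∈floor a< = ∈-++⁺ʳ west (∈-++⁺ʳ east (∈-++⁺ˡ (∈-map⁺ (λ a → pt (suc a) 0) (∈-upTo⁺ a<))))

  ∈roof : ∀ {a} → a ≤ j → pt (suc a) (2 + g) ∈ cover
  ∈roof a≤ =
    ∈-++⁺ʳ west (∈-++⁺ʳ east (∈-++⁺ʳ floor (∈-++⁺ˡ (∈-map⁺ (λ a → pt (suc a) (2 + g)) (∈-upTo⁺ (s≤s a≤))))))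

  ∈ledge : ∀ {c} → j ≤ c → c ≤ w → pt (suc c) (suc g) ∈ cover
  ∈ledge j≤c c≤w with t , refl ← ℕ.m≤n⇒∃[o]m+o≡n j≤c =
    ∈-++⁺ʳ west (∈-++⁺ʳ east (∈-++⁺ʳ floor (∈-++⁺ʳ roof
      (∈-map⁺ (λ t → pt (suc (j + t)) (suc g)) (∈-upTo⁺ (s≤s t≤w∸j))))))
    where
    t≤w∸j : t ≤ w ∸ j
    t≤w∸j = ℕ.m+n≤o⇒m≤o∸n t (subst (_≤ w) (ℕ.+-comm j t) c≤w)

  neighbour-column≤w : ∀ {c a b} → Cell (a , b) → suc c ≤ 2 + a → c ≤ w
  neighbour-column≤w (body a<w _) c≤ = ℕ.≤-trans (ℕ.≤-pred c≤) a<w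
  neighbour-column≤w (cap a<j) c≤ = ℕ.≤-trans (ℕ.≤-pred c≤) (ℕ.≤-trans a<j j≤w)

  cell-row : ∀ {a b} → Cell (a , b) → b ≤ g
  cell-row (body _ b<g) = ℕ.<⇒≤ b<g
  cell-row (cap _) = ℕ.≤-refl

  cell-top-row : ∀ {a b} → Cell (a , b) → g ≤ b → a < j
  cell-top-row (body _ b<g) g≤b = ⊥-elim (ℕ.<⇒≱ b<g g≤b)
  cell-top-row (cap a<j) _ = a<j

  -- c ≤ 2 + a and e ≤ 2 + b is all that is used of pt c e being a d₈-neighbour of cell (a , b)
  frame : ∀ {c e a b} → Cell (a , b) → c ≤ 2 + a → e ≤ 2 + b → pt c e ∉ T → pt c e ∈ cover
  frame {zero} cl _ e≤ _ = ∈west (ℕ.≤-trans e≤ (s≤s (s≤s (cell-row cl))))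
  frame {suc c} {zero} cl c≤ _ _ with c ℕ.<? w
  ... | yes c<w = ∈floor c<w
  ... | no c≮w rewrite ℕ.≤-antisym (neighbour-column≤w cl c≤) (ℕ.≮⇒≥ c≮w) = ∈east z≤n
  frame {suc c} {suc e} cl c≤ e≤ p∉T with ℕ.<-cmp e g
  ... | tri< e<g _ _ with c ℕ.<? w
  ...   | yes c<w = ⊥-elim (p∉T (cell∈T (body c<w e<g)))
  ...   | no c≮w rewrite ℕ.≤-antisym (neighbour-column≤w cl c≤) (ℕ.≮⇒≥ c≮w) = ∈east e<g
  frame {suc c} {suc e} cl c≤ e≤ p∉T | tri≈ _ refl _ with c ℕ.<? j
  ...   | yes c<j = ⊥-elim (p∉T (cell∈T (cap c<j)))
  ...   | no c≮j = ∈ledge (ℕ.≮⇒≥ c≮j) (neighbour-column≤w cl c≤)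
  frame {suc c} {suc e} cl c≤ e≤ p∉T | tri> _ _ g<e
    rewrite ℕ.≤-antisym (ℕ.≤-trans (ℕ.≤-pred e≤) (s≤s (cell-row cl))) g<e =
    ∈roof (ℕ.≤-trans (ℕ.≤-pred c≤) (cell-top-row cl (ℕ.≤-pred (ℕ.≤-trans g<e (ℕ.≤-pred e≤)))))

  P8⊆cover : ∀ {p} → InP8 T p → p ∈ cover
  P8⊆cover {x , y} (p∉T , q , q∈T , d≡1)
    with (a , b) , refl , cl ← ∈T⇒cell q∈T
    with c , refl , c≤ ← ∣i-[1+a]∣≤1⇒i≤2+a x a (ℕ.≤-trans (ℕ.m≤m⊔n _ _) (ℕ.≤-reflexive d≡1))
    with e , refl , e≤ ← ∣i-[1+a]∣≤1⇒i≤2+a y b (ℕ.≤-trans (ℕ.m≤n⊔m _ _) (ℕ.≤-reflexive d≡1))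
    = frame cl c≤ e≤ p∉T

  length-cover : length cover ≡ 2 * (w + suc g) + 4
  length-cover with t , refl ← ℕ.m≤n⇒∃[o]m+o≡n j≤w = begin
    length cover
      ≡⟨ lengths ⟩
    (3 + g) + (suc g + ((j + t) + (suc j + suc ((j + t) ∸ j))))
      ≡⟨ cong (λ n → (3 + g) + (suc g + ((j + t) + (suc j + suc n)))) (ℕ.m+n∸m≡n j t) ⟩
    (3 + g) + (suc g + ((j + t) + (suc j + suc t)))
      ≡⟨ count g j t ⟩
    2 * ((j + t) + suc g) + 4 ∎
    where
    open ≡-Reasoning
    count : ∀ g j t → (3 + g) + (suc g + ((j + t) + (suc j + suc t))) ≡ 2 * ((j + t) + suc g) + 4
    count = solve-∀
    segment : ∀ (f : ℕ → Point) n → length (map f (upTo n)) ≡ n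
    segment f n = trans (length-map f (upTo n)) (length-upTo n)
    lengths : length cover ≡ (3 + g) + (suc g + ((j + t) + (suc j + suc ((j + t) ∸ j))))
    lengths = trans (length-++ west) (cong₂ _+_ (segment (pt 0) (3 + g))
             (trans (length-++ east) (cong₂ _+_ (segment (pt (suc w)) (suc g))
             (trans (length-++ floor) (cong₂ _+_ (segment (λ a → pt (suc a) 0) w)
             (trans (length-++ roof) (cong₂ _+_ (segment (λ a → pt (suc a) (2 + g)) (suc j))
                                                (segment (λ t → pt (suc (j + t)) (suc g)) (suc (w ∸ j))))))))))

σ8-attained : ∀ k → 1 ≤ k →
  Σ[ T ∈ List Point ] (Unique T × length T ≡ k × Connected8 T ×
    Σ[ P ∈ List Point ] (EnumP8 T P × length P ≡ σ8 k))
σ8-attained k@(suc k′) 1≤k = T , T-unique , |T|≡k , T-connected , P , P-enum ,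
  ℕ.≤-antisym |P|≤σ8 σ8≤|P|
  where
  s w h : ℕ
  s = ceilSqrt (4 * k)
  w = ⌊ s /2⌋
  h = ⌈ s /2⌉
  k≤wh : k ≤ w * h
  k≤wh = 4k≤s²⇒k≤⌊s/2⌋*⌈s/2⌉ k s (ceilSqrt-sound (4 * k))
  instance
    w-nonZero : ℕ.NonZero w
    w-nonZero = ℕ.≢-nonZero λ w≡0 → ℕ.≤⇒≯ (subst (λ v → k ≤ v * h) w≡0 k≤wh) 1≤k
  g r : ℕ
  g = k′ / w
  r = k′ % w
  open Staircase w g (suc r) (m%n<n k′ w)
  |T|≡k : length T ≡ k
  |T|≡k = begin
    length T         ≡⟨ T-length ⟩
    w * g + suc r    ≡⟨ ℕ.+-suc (w * g) r ⟩
    suc (w * g + r)  ≡⟨ cong suc (trans (cong (_+ r) (ℕ.*-comm w g)) (ℕ.+-comm (g * w) r)) ⟩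
    suc (r + g * w)  ≡⟨ cong suc (m≡m%n+[m/n]*n k′ w) ⟨
    k                ∎
    where open ≡-Reasoning
  g<h : g < h
  g<h = ℕ.*-cancelʳ-< w g h (begin-strict
    g * w    ≤⟨ m/n*n≤m k′ w ⟩
    k′       <⟨ ℕ.n<1+n k′ ⟩
    k        ≤⟨ k≤wh ⟩
    w * h    ≡⟨ ℕ.*-comm w h ⟩
    h * w    ∎)
    where open ℕ.≤-Reasoning
  enum : ∃[ P ] EnumP8 T P × length P ≤ length cover
  enum = EnumP8-from-cover T cover P8⊆cover
  P : List Point
  P = proj₁ enum
  P-enum : EnumP8 T P
  P-enum = proj₁ (proj₂ enum)
  |P|≤σ8 : length P ≤ σ8 k
  |P|≤σ8 = begin
    length P                ≤⟨ proj₂ (proj₂ enum) ⟩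
    length cover            ≡⟨ length-cover ⟩
    2 * (w + suc g) + 4     ≤⟨ ℕ.+-monoˡ-≤ 4 (ℕ.*-monoʳ-≤ 2 (ℕ.+-monoʳ-≤ w g<h)) ⟩
    2 * (w + h) + 4         ≡⟨ cong (λ n → 2 * n + 4) (ℕ.⌊n/2⌋+⌈n/2⌉≡n s) ⟩
    σ8 k                    ∎
    where open ℕ.≤-Reasoning
  σ8≤|P| : σ8 k ≤ length P
  σ8≤|P| = subst (λ n → σ8 n ≤ length P) |T|≡k (σ8≤|P8| T (cell∈T (cap ℕ.z<s)) T-unique P P-enum)

lemma2p13 :
    ((k : ℕ) → 1 ≤ k → (T : List Point) → Unique T → length T ≡ k → Connected8 T →
      (P : List Point) → EnumP8 T P → σ8 k ≤ length P)
    ×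
    ((k : ℕ) → 1 ≤ k →
      Σ[ T ∈ List Point ] (Unique T × length T ≡ k × Connected8 T ×
        Σ[ P ∈ List Point ] (EnumP8 T P × length P ≡ σ8 k)))
lemma2p13 = lower-bound , σ8-attained
  where
  lower-bound : (k : ℕ) → 1 ≤ k → (T : List Point) → Unique T → length T ≡ k → Connected8 T →
                (P : List Point) → EnumP8 T P → σ8 k ≤ length P
  lower-bound .0 () [] _ refl
  lower-bound _ _ (q ∷ T) T! refl _ = σ8≤|P8| (q ∷ T) (here refl) T!
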